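{- Let $A$ be a $\{ -,\triangleright\}$-algebra satisfying (Ax.1)–(Ax.5). Let $\mathrm{mf}(A)$ be the set of maximal filters of $(A,\cdot)$ and for $a\in A$ define $$a^\theta:=\{(\xi,\mu)\in\mathrm{mf}(A)\times\mathrm{mf}(A)\mid \xi\approx\mu\text{ and }a\in\mu\}.$$ Then each $a^\theta$ is a partial function on $\mathrm{mf}(A)$, and $a\mapsto a^\theta$ is an injective map satisfying $(a-b)^\theta=a^\theta-b^\theta$ and $(a\triangleright b)^\theta=a^\theta\triangleright b^\theta$; that is, $\theta$ is a representation of $A$ by partial functions.
   Context: A $\{ -,\triangleright\}$-algebra is a set $A$ with binary operations $-$ and $\triangleright$. Write $a\cdot b:=a-(a-b)$. The axioms are: (Ax.1) $a-(b-a)=a$; (Ax.2) $a\cdot b=b\cdot a$; (Ax.3) $(a-b)-c=(a-c)-b$; (Ax.4) $(a\triangleright c)\cdot(b\triangleright c)=(a\triangleright b)\triangleright c$; (Ax.5) $(a\cdot b)\triangleright a=a\cdot b$. Under these, $(A,\cdot)$ is a meet-semilattice with bottom $0=a-a$, ordered by $a\le b\iff a\cdot b=a$. A filter is a nonempty upward closed subset closed under $\cdot$; a maximal filter is a proper filter ($\neq A$) maximal among proper filters under inclusion. For filters $F,G$ let $G\triangleright F=\{g\triangleright f\mid g\in G,f\in F\}$ and define the preorder $F\preceq G\iff G\triangleright F\subseteq F$; $\approx$ is the equivalence relation $F\approx G\iff F\preceq G$ and $G\preceq F$. On partial functions, $f-g=\{(x,y)\in f\mid (x,y)\notin g\}$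 and $f\triangleright g=\{(x,y)\in g\mid x\in\mathrm{dom}(f)\}$. -}

module Defs where

open import Level using (Level; _⊔_; Lift) renaming (suc to lsuc; zero to lzero)
open import Data.Product using (Σ; _×_; _,_; ∃)
open import Data.Sum using (_⊎_)
open import Relation.Nullary using (¬_)
open import Relation.Binary.PropositionalEquality using (_≡_)

infix 4 _⇔_

_⇔_ : ∀ {a b} → Set a → Set b → Set (a ⊔ b)
P ⇔ Q = (P → Q) × (Q → P)

LEM : Set₂
LEM = (P : Set₁) → P ⊎ ¬ P

Zorn : Set₂
Zorn = (P : Set₁) (_≤_ : P → P → Set)
     → (∀ x → x ≤ x)
     → (∀ {x y z} → x ≤ y → y ≤ z → x ≤ z)
     → ((C : P → Set) → (∀ {x y} → C x → C y → (x ≤ y) ⊎ (y ≤ x))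
          → Σ P (λ u → ∀ {x} → C x → x ≤ u))
     → Σ P (λ m → ∀ y → m ≤ y → y ≤ m)

record MinusRestrictAlgebra : Set₁ where
  infixl 6 _-_
  infixl 5 _▷_
  infixl 7 _·_
  field
    Carrier : Set
    _-_     : Carrier → Carrier → Carrier
    _▷_     : Carrier → Carrier → Carrier

  _·_ : Carrier → Carrier → Carrier
  a · b = a - (a - b)

  field
    ax1 : ∀ a b → a - (b - a) ≡ a
    ax2 : ∀ a b → a · b ≡ b · a
    ax3 : ∀ a b c → (a - b) - c ≡ (a - c) - b
    ax4 : ∀ a b c → (a ▷ c) · (b ▷ c) ≡ (a ▷ b) ▷ c
    ax5 : ∀ a b → (a · b) ▷ a ≡ a · b

module Theory (𝔸 : MinusRestrictAlgebra) where
  open MinusRestrictAlgebra 𝔸 public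

  Subset : Set₁
  Subset = Carrier → Set

  _∈_ : Carrier → Subset → Set
  a ∈ F = F a

  _⊆_ : Subset → Subset → Set
  F ⊆ G = ∀ a → a ∈ F → a ∈ G

  _≤_ : Carrier → Carrier → Set
  a ≤ b = a · b ≡ a

  record IsFilter (F : Subset) : Set where
    field
      nonempty   : ∃ λ a → a ∈ F
      upClosed   : ∀ a b → a ∈ F → a ≤ b → b ∈ F
      meetClosed : ∀ a b → a ∈ F → b ∈ F → (a · b) ∈ F

  Proper : Subset → Set
  Proper F = ∃ λ a → ¬ (a ∈ F)

  record IsMaximalFilter (F : Subset) : Set₁ where
    field
      filter  : IsFilter F
      proper  : Proper F
      maximal : ∀ G → IsFilter G → Proper G → F ⊆ G → G ⊆ F

  MF : Set₁
  MF = Σ Subset IsMaximalFilter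

  set : MF → Subset
  set (F , _) = F

  _≐_ : MF → MF → Set
  ξ ≐ μ = (set ξ ⊆ set μ) × (set μ ⊆ set ξ)

  _⪯_ : Subset → Subset → Set
  F ⪯ G = ∀ g f → g ∈ G → f ∈ F → (g ▷ f) ∈ F

  _≈_ : Subset → Subset → Set
  F ≈ G = (F ⪯ G) × (G ⪯ F)

  Rel : Set₂
  Rel = MF → MF → Set₁

  IsPartialFunction : Rel → Set₁
  IsPartialFunction R = ∀ ξ μ ν → R ξ μ → R ξ ν → μ ≐ ν

  _≡ᴿ_ : Rel → Rel → Set₁
  R ≡ᴿ S = ∀ ξ μ → R ξ μ ⇔ S ξ μ

  _-ᴿ_ : Rel → Rel → Rel
  (R -ᴿ S) ξ μ = R ξ μ × ¬ S ξ μ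

  _▷ᴿ_ : Rel → Rel → Rel
  (R ▷ᴿ S) ξ μ = S ξ μ × Σ MF (λ ν → R ξ ν)

  θ : Carrier → Rel
  θ a ξ μ = Lift (lsuc lzero) ((set ξ ≈ set μ) × a ∈ set μ)

-- Maximal filters are prime for subtraction: by maximality, b ∉ μ gives some
-- f ∈ μ with f · b = 0, so a ∈ μ, b ∉ μ forces a - b ∈ μ; this is the clause for
-- a - b. For a ▷ b the domain point ν of ξ is {y | (y · a) ▷ c ∈ ξ} for any
-- c ∈ ξ. Partiality holds because b ∈ μ ∖ ν with a ∈ μ ∩ ν would put
-- ((a · b) ▷ c) · ((a - b) ▷ c) = 0 ▷ c = 0 into ξ. Injectivity uses Zorn's lemma
-- to find a maximal filter containing a - b whenever a ≰ b.
module Submission where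

open import Defs
open import Data.Product using (_×_; Σ; _,_; ∃; proj₁; proj₂)
open import Data.Sum using (_⊎_; inj₁; inj₂)
open import Data.Unit using (⊤; tt)
open import Data.Empty using (⊥; ⊥-elim)
open import Level using (Lift; lift; lower) renaming (suc to lsuc; zero to lzero)
open import Relation.Nullary using (¬_)
open import Relation.Binary.PropositionalEquality
  using (_≡_; sym; trans; cong; cong₂; subst; module ≡-Reasoning)

module Laws (𝔸 : MinusRestrictAlgebra) where
  open Theory 𝔸
  open ≡-Reasoning

  x-x≡y-y : ∀ x y → x - x ≡ y - y
  x-x≡y-y x y = begin
    x - x                           ≡⟨ cong (x -_) (sym (ax1 x y)) ⟩
    x · (y - x)                     ≡⟨ ax2 x (y - x) ⟩
    (y - x) · x                     ≡⟨ cong (λ □ → (y - x) - ((y - x) - □)) (sym (ax1 x y)) ⟩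
    (y - x) · (x - (y - x))         ≡⟨ cong ((y - x) -_) (ax1 (y - x) x) ⟩
    (y - x) - (y - x)               ≡⟨ cong (λ □ → (y - x) - (□ - x)) (sym (ax1 y x)) ⟩
    (y - x) - ((y - (x - y)) - x)   ≡⟨ cong ((y - x) -_) (ax3 y (x - y) x) ⟩
    (y - x) · (x - y)               ≡⟨ ax2 (y - x) (x - y) ⟩
    (x - y) · (y - x)               ≡⟨ cong ((x - y) -_) (sym (ax3 x (y - x) y)) ⟩
    (x - y) - ((x - (y - x)) - y)   ≡⟨ cong (λ □ → (x - y) - (□ - y)) (ax1 x y) ⟩
    (x - y) - (x - y)               ≡⟨ cong ((x - y) -_) (sym (ax1 (x - y) y)) ⟩
    (x - y) · (y - (x - y))         ≡⟨ cong (λ □ → (x - y) - ((x - y) - □)) (ax1 y x) ⟩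
    (x - y) · y                     ≡⟨ sym (ax2 y (x - y)) ⟩
    y · (x - y)                     ≡⟨ cong (y -_) (ax1 y x) ⟩
    y - y                           ∎

  x-x≤y : ∀ x y → (x - x) ≤ y
  x-x≤y x y = begin
    (x - x) · y                ≡⟨ ax3 x x ((x - x) - y) ⟩
    (x - ((x - x) - y)) - x    ≡⟨ cong (λ □ → (x - □) - x) (ax3 x x y) ⟩
    (x - ((x - y) - x)) - x    ≡⟨ cong (_- x) (ax1 x (x - y)) ⟩
    x - x                      ∎

  x-[y-y]≡x : ∀ x y → x - (y - y) ≡ x
  x-[y-y]≡x x y = trans (cong (x -_) (x-x≡y-y y x)) (ax1 x x)

  [x-x]-y≡x-x : ∀ x y → (x - x) - y ≡ x - x
  [x-x]-y≡x-x x y = trans (cong ((x - x) -_) (sym (x-[y-y]≡x y x))) (ax1 (x - x) y)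

  x·y≤x : ∀ x y → (x · y) ≤ x
  x·y≤x x y = trans (ax3 x (x - y) ((x · y) - x)) (cong (_- (x - y)) (ax1 x (x · y)))

  x·y≤y : ∀ x y → (x · y) ≤ y
  x·y≤y x y = trans (cong ((x · y) -_) (ax3 x (x - y) y)) (x-[y-y]≡x (x · y) (x - y))

  x-y≤x : ∀ x y → (x - y) ≤ x
  x-y≤x x y = trans (ax3 x y ((x - y) - x)) (cong (_- y) (ax1 x (x - y)))

  [x-y]·y≡x-x : ∀ x y → (x - y) · y ≡ x - x
  [x-y]·y≡x-x x y = begin
    (x - y) · y   ≡⟨ ax2 (x - y) y ⟩
    y · (x - y)   ≡⟨ cong (y -_) (ax1 y x) ⟩
    y - y         ≡⟨ x-x≡y-y y x ⟩
    x - x         ∎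

  ≤-refl : ∀ x → x ≤ x
  ≤-refl x = ax1 x x

  ≤-antisym : ∀ {x y} → x ≤ y → y ≤ x → x ≡ y
  ≤-antisym {x} {y} x≤y y≤x = trans (sym x≤y) (trans (ax2 x y) y≤x)

  ≤-trans : ∀ {x y z} → x ≤ y → y ≤ z → x ≤ z
  ≤-trans {x} {y} {z} x≤y y≤z = begin
    x · z                                ≡⟨ cong (_- (x - z)) (sym x≤y) ⟩
    (x · y) - (x - z)                    ≡⟨ cong (_- (x - z)) (ax2 x y) ⟩
    (y · x) - (x - z)                    ≡⟨ ax3 y (y - x) (x - z) ⟩
    (y - (x - z)) - (y - x)              ≡⟨ cong (λ □ → (□ - (x - z)) - (y - x)) (sym y≤z) ⟩
    ((y · z) - (x - z)) - (y - x)        ≡⟨ cong (λ □ → (□ - (x - z)) - (y - x)) (ax2 y z) ⟩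
    ((z · y) - (x - z)) - (y - x)        ≡⟨ cong (_- (y - x)) (ax3 z (z - y) (x - z)) ⟩
    ((z - (x - z)) - (z - y)) - (y - x)  ≡⟨ cong (λ □ → (□ - (z - y)) - (y - x)) (ax1 z x) ⟩
    (z · y) - (y - x)                    ≡⟨ cong (_- (y - x)) (trans (sym (ax2 y z)) y≤z) ⟩
    y · x                                ≡⟨ sym (ax2 x y) ⟩
    x · y                                ≡⟨ x≤y ⟩
    x                                    ∎

  x≤a-a⇒x≡a-a : ∀ {x} a → x ≤ (a - a) → x ≡ a - a
  x≤a-a⇒x≡a-a {x} a x≤0 = trans (sym x≤0) (trans (ax2 x (a - a)) (x-x≤y a x))

  ≤⇒x-y≡x-x : ∀ {x y} → x ≤ y → x - y ≡ x - x
  ≤⇒x-y≡x-x {x} {y} x≤y = begin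
    x - y               ≡⟨ sym (ax1 (x - y) x) ⟩
    (x - y) - (x · y)   ≡⟨ cong ((x - y) -_) x≤y ⟩
    (x - y) - x         ≡⟨ sym (ax3 x x y) ⟩
    (x - x) - y         ≡⟨ [x-x]-y≡x-x x y ⟩
    x - x               ∎

  x-y≡x-x⇒≤ : ∀ {x y} → x - y ≡ x - x → x ≤ y
  x-y≡x-x⇒≤ {x} x-y≡0 = trans (cong (x -_) x-y≡0) (ax1 x x)

  x≤y-z : ∀ {x y z} → x ≤ y → x · z ≡ z - z → x ≤ (y - z)
  x≤y-z {x} {y} {z} x≤y x·z≡0 = begin
    x · (y - z)                              ≡⟨ cong (_- (x - (y - z))) (sym (ax1 x y)) ⟩
    (x - (y - x)) - (x - (y - z))            ≡⟨ ax3 x (y - x) (x - (y - z)) ⟩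
    (x · (y - z)) - (y - x)                  ≡⟨ cong (_- (y - x)) (ax2 x (y - z)) ⟩
    ((y - z) · x) - (y - x)                  ≡⟨ ax3 (y - z) ((y - z) - x) (y - x) ⟩
    ((y - z) - (y - x)) - ((y - z) - x)      ≡⟨ cong (_- ((y - z) - x)) (ax3 y z (y - x)) ⟩
    ((y · x) - z) - ((y - z) - x)            ≡⟨ ax3 (y · x) z ((y - z) - x) ⟩
    ((y · x) - ((y - z) - x)) - z            ≡⟨ cong (λ □ → (□ - ((y - z) - x)) - z) (ax2 y x) ⟩
    ((x · y) - ((y - z) - x)) - z            ≡⟨ cong (_- z) (ax3 x (x - y) ((y - z) - x)) ⟩
    ((x - ((y - z) - x)) - (x - y)) - z      ≡⟨ cong (λ □ → (□ - (x - y)) - z) (ax1 x (y - z)) ⟩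
    (x · y) - z                              ≡⟨ cong (_- z) x≤y ⟩
    x - z                                    ≡⟨ sym (x-y≤x x z) ⟩
    (x - z) · x                              ≡⟨ sym (ax2 x (x - z)) ⟩
    x · (x - z)                              ≡⟨ cong (x -_) x·z≡0 ⟩
    x - (z - z)                              ≡⟨ x-[y-y]≡x x z ⟩
    x                                        ∎

  x-[y·x]≡x-y : ∀ x y → x - (y · x) ≡ x - y
  x-[y·x]≡x-y x y = begin
    x - (y · x)             ≡⟨ cong (x -_) (ax2 y x) ⟩
    x · (x - y)             ≡⟨ ax2 x (x - y) ⟩
    (x - y) · x             ≡⟨ cong ((x - y) -_) (ax3 x y x) ⟩
    (x - y) - ((x - x) - y) ≡⟨ cong ((x - y) -_) ([x-x]-y≡x-x x y) ⟩
    (x - y) - (x - x)       ≡⟨ x-[y-y]≡x (x - y) x ⟩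
    x - y                   ∎

  glb : ∀ {x y z} → z ≤ x → z ≤ y → z ≤ (x · y)
  glb {x} {y} {z} z≤x z≤y =
    x-y≡x-x⇒≤ (trans (z-[x·y]≡x-x (≤⇒z-w≡x-x z≤x) (≤⇒z-w≡x-x z≤y)) (x-x≡y-y x z))
    where
    ≤⇒z-w≡x-x : ∀ {w} → z ≤ w → z - w ≡ x - x
    ≤⇒z-w≡x-x z≤w = trans (≤⇒x-y≡x-x z≤w) (x-x≡y-y z x)

    z-[x·y]≡x-x : z - x ≡ x - x → z - y ≡ x - x → z - (x · y) ≡ x - x
    z-[x·y]≡x-x z-x≡0 z-y≡0 = begin
      z - (x · y)                               ≡⟨ cong (_- (x · y)) (sym (x-[y-y]≡x z x)) ⟩
      (z - (x - x)) - (x · y)                   ≡⟨ cong (λ □ → (z - □) - (x · y)) (sym z-x≡0) ⟩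
      (z · x) - (x · y)                         ≡⟨ cong (_- (x · y)) (ax2 z x) ⟩
      (x · z) - (x · y)                         ≡⟨ ax3 x (x - z) (x · y) ⟩
      (x · (x - y)) - (x - z)                   ≡⟨ cong (_- (x - z)) (ax2 x (x - y)) ⟩
      ((x - y) · x) - (x - z)                   ≡⟨ ax3 (x - y) ((x - y) - x) (x - z) ⟩
      ((x - y) - (x - z)) - ((x - y) - x)       ≡⟨ cong (_- ((x - y) - x)) (ax3 x y (x - z)) ⟩
      ((x · z) - y) - ((x - y) - x)             ≡⟨ cong (((x · z) - y) -_) (sym (ax3 x x y)) ⟩
      ((x · z) - y) - ((x - x) - y)             ≡⟨ cong (λ □ → (□ - y) - ((x - x) - y)) (sym (ax2 z x)) ⟩
      ((z · x) - y) - ((x - x) - y)             ≡⟨ cong (λ □ → ((z - □) - y) - ((x - x) - y)) z-x≡0 ⟩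
      ((z - (x - x)) - y) - ((x - x) - y)       ≡⟨ cong (λ □ → (□ - y) - ((x - x) - y)) (x-[y-y]≡x z x) ⟩
      (z - y) - ((x - x) - y)                   ≡⟨ cong (_- ((x - x) - y)) z-y≡0 ⟩
      (x - x) · y                               ≡⟨ x-x≤y x y ⟩
      x - x                                     ∎

  ·-monoˡ-≤ : ∀ {x y} z → x ≤ y → (x · z) ≤ (y · z)
  ·-monoˡ-≤ {x} z x≤y = glb (≤-trans (x·y≤x x z) x≤y) (x·y≤y x z)

  ≤⇒x▷y≡x : ∀ {x y} → x ≤ y → x ▷ y ≡ x
  ≤⇒x▷y≡x {x} {y} x≤y = begin
    x ▷ y         ≡⟨ cong (_▷ y) (trans (sym x≤y) (ax2 x y)) ⟩
    (y · x) ▷ y   ≡⟨ ax5 y x ⟩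
    y · x         ≡⟨ trans (sym (ax2 x y)) x≤y ⟩
    x             ∎

  ▷-idem : ∀ x → x ▷ x ≡ x
  ▷-idem x = ≤⇒x▷y≡x (≤-refl x)

  ▷-monoˡ-≤ : ∀ {x y} z → x ≤ y → (x ▷ z) ≤ (y ▷ z)
  ▷-monoˡ-≤ {x} {y} z x≤y = trans (ax4 x y z) (cong (_▷ z) (≤⇒x▷y≡x x≤y))

  -- u - y lies below y (via u ≤ y ▷ u, which is (Ax.4)) and is disjoint from y, hence 0.
  x▷y≤y : ∀ x y → (x ▷ y) ≤ y
  x▷y≤y x y = x-y≡x-x⇒≤ (trans (sym p≤y) ([x-y]·y≡x-x u y))
    where
    u : Carrier
    u = x ▷ y
    p : Carrier
    p = u - y
    p≤u : p ≤ u
    p≤u = x-y≤x u y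
    u≤y▷u : u ≤ (y ▷ u)
    u≤y▷u = subst (λ t → t · (y ▷ u) ≡ t) (trans (ax4 x y u) (▷-idem u)) (x·y≤y (x ▷ u) (y ▷ u))
    p≡[p▷y]▷u : p ≡ (p ▷ y) ▷ u
    p≡[p▷y]▷u = begin
      p                     ≡⟨ sym (≤-trans p≤u u≤y▷u) ⟩
      p · (y ▷ u)           ≡⟨ cong (_· (y ▷ u)) (sym (≤⇒x▷y≡x p≤u)) ⟩
      (p ▷ u) · (y ▷ u)     ≡⟨ ax4 p y u ⟩
      (p ▷ y) ▷ u           ∎
    p▷y≤u·y : (p ▷ y) ≤ (u · y)
    p▷y≤u·y = subst ((p ▷ y) ≤_) (sym (trans (cong (u ·_) (sym (▷-idem y))) (ax4 x y y)))
                    (▷-monoˡ-≤ y p≤u)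
    p≤y : p ≤ y
    p≤y = subst (_≤ y) (sym (trans p≡[p▷y]▷u (≤⇒x▷y≡x (≤-trans p▷y≤u·y (x·y≤x u y)))))
                (≤-trans p▷y≤u·y (x·y≤y u y))

  x▷[x▷y]≡x▷y : ∀ x y → x ▷ (x ▷ y) ≡ x ▷ y
  x▷[x▷y]≡x▷y x y = ≤-antisym (x▷y≤y x u) u≤x▷u
    where
    u : Carrier
    u = x ▷ y
    u≤x▷u : u ≤ (x ▷ u)
    u≤x▷u = subst (λ t → t · (x ▷ u) ≡ t) (trans (ax4 x y u) (▷-idem u)) (x·y≤x (x ▷ u) (y ▷ u))

  [x▷y]▷z≤x▷z : ∀ x y z → ((x ▷ y) ▷ z) ≤ (x ▷ z)
  [x▷y]▷z≤x▷z x y z =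
    trans (ax2 ((x ▷ y) ▷ z) (x ▷ z)) (trans (ax4 x (x ▷ y) z) (cong (_▷ z) (x▷[x▷y]≡x▷y x y)))

  ▷-monoʳ-≤ : ∀ {x y} z → x ≤ y → (z ▷ x) ≤ (z ▷ y)
  ▷-monoʳ-≤ {x} {y} z x≤y = subst (λ t → t · (z ▷ y) ≡ t) [z▷y]·x≡z▷x (x·y≤x (z ▷ y) x)
    where
    [z▷y]·x≡z▷x : (z ▷ y) · x ≡ z ▷ x
    [z▷y]·x≡z▷x = begin
      (z ▷ y) · x         ≡⟨ cong ((z ▷ y) ·_) (sym (≤⇒x▷y≡x x≤y)) ⟩
      (z ▷ y) · (x ▷ y)   ≡⟨ ax4 z x y ⟩
      (z ▷ x) ▷ y         ≡⟨ ≤⇒x▷y≡x (≤-trans (x▷y≤y z x) x≤y) ⟩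
      z ▷ x               ∎

  ≤-common⇒x▷y≡x·y : ∀ {x y a} → x ≤ a → y ≤ a → x ▷ y ≡ x · y
  ≤-common⇒x▷y≡x·y {x} {y} {a} x≤a y≤a = begin
    x ▷ y               ≡⟨ sym (≤⇒x▷y≡x (≤-trans (x▷y≤y x y) y≤a)) ⟩
    (x ▷ y) ▷ a         ≡⟨ sym (ax4 x y a) ⟩
    (x ▷ a) · (y ▷ a)   ≡⟨ cong₂ _·_ (≤⇒x▷y≡x x≤a) (≤⇒x▷y≡x y≤a) ⟩
    x · y               ∎

  [x-x]▷y≡x-x : ∀ x y → (x - x) ▷ y ≡ x - x
  [x-x]▷y≡x-x x y = begin
    (x - x) ▷ y   ≡⟨ cong (_▷ y) (x-x≡y-y x y) ⟩
    (y - y) ▷ y   ≡⟨ ≤-common⇒x▷y≡x·y (x-x≤y y y) (≤-refl y) ⟩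
    (y - y) · y   ≡⟨ x-x≤y y y ⟩
    y - y         ≡⟨ x-x≡y-y y x ⟩
    x - x         ∎

  [x·y]▷[x-y]≡x-x : ∀ x y → (x · y) ▷ (x - y) ≡ x - x
  [x·y]▷[x-y]≡x-x x y = trans (≤-common⇒x▷y≡x·y (x·y≤x x y) (x-y≤x x y)) (x≤a-a⇒x≡a-a x meet≤0)
    where
    meet≤0 : ((x · y) · (x - y)) ≤ (x - x)
    meet≤0 = subst (((x · y) · (x - y)) ≤_) (trans (ax2 y (x - y)) ([x-y]·y≡x-x x y))
                   (·-monoˡ-≤ (x - y) (x·y≤y x y))

  x≤y▷z⇒[x▷y]▷z≡x : ∀ {x y z} → x ≤ (y ▷ z) → (x ▷ y) ▷ z ≡ x
  x≤y▷z⇒[x▷y]▷z≡x {x} {y} {z} x≤y▷z = begin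
    (x ▷ y) ▷ z         ≡⟨ sym (ax4 x y z) ⟩
    (x ▷ z) · (y ▷ z)   ≡⟨ cong (_· (y ▷ z)) (≤⇒x▷y≡x (≤-trans x≤y▷z (x▷y≤y y z))) ⟩
    x · (y ▷ z)         ≡⟨ x≤y▷z ⟩
    x                   ∎

  ≤-disjoint⇒x▷y≡0 : ∀ {w s c} → w ≤ c → w · (s ▷ c) ≡ c - c → w ▷ s ≡ c - c
  ≤-disjoint⇒x▷y≡0 {w} {s} {c} w≤c w·[s▷c]≡0 = begin
    e                   ≡⟨ sym e≤c▷s ⟩
    e · (c ▷ s)         ≡⟨ cong (_· (c ▷ s)) (sym (≤⇒x▷y≡x (x▷y≤y w s))) ⟩
    (e ▷ s) · (c ▷ s)   ≡⟨ ax4 e c s ⟩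
    (e ▷ c) ▷ s         ≡⟨ cong (_▷ s) e▷c≡0 ⟩
    (c - c) ▷ s         ≡⟨ [x-x]▷y≡x-x c s ⟩
    c - c               ∎
    where
    e : Carrier
    e = w ▷ s
    e▷c≡0 : e ▷ c ≡ c - c
    e▷c≡0 = trans (sym (ax4 w s c)) (trans (cong (_· (s ▷ c)) (≤⇒x▷y≡x w≤c)) w·[s▷c]≡0)
    e≤c▷s : e ≤ (c ▷ s)
    e≤c▷s = trans (ax4 w c s) (cong (_▷ s) (≤⇒x▷y≡x w≤c))

  [k▷c]-[s▷c]≤[k-s]▷c : ∀ {s k} c → s ≤ k → ((k ▷ c) - (s ▷ c)) ≤ ((k - s) ▷ c)
  [k▷c]-[s▷c]≤[k-s]▷c {s} {k} c s≤k =
    subst (_≤ ((k - s) ▷ c)) (x≤y▷z⇒[x▷y]▷z≡x w≤k▷c) (▷-monoˡ-≤ c w▷k≤k-s)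
    where
    w : Carrier
    w = (k ▷ c) - (s ▷ c)
    w≤k▷c : w ≤ (k ▷ c)
    w≤k▷c = x-y≤x (k ▷ c) (s ▷ c)
    w▷s≡0 : w ▷ s ≡ (k ▷ c) - (k ▷ c)
    w▷s≡0 = trans (≤-disjoint⇒x▷y≡0 (≤-trans w≤k▷c (x▷y≤y k c))
                     (trans ([x-y]·y≡x-x (k ▷ c) (s ▷ c)) (x-x≡y-y (k ▷ c) c)))
                  (x-x≡y-y c (k ▷ c))
    [w▷k]·s≡0 : (w ▷ k) · s ≡ (k ▷ c) - (k ▷ c)
    [w▷k]·s≡0 = trans (sym (≤-common⇒x▷y≡x·y (x▷y≤y w k) s≤k))
                      (x≤a-a⇒x≡a-a (k ▷ c) (subst (((w ▷ k) ▷ s) ≤_) w▷s≡0 ([x▷y]▷z≤x▷z w k s)))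
    w▷k≤k-s : (w ▷ k) ≤ (k - s)
    w▷k≤k-s = x≤y-z (x▷y≤y w k) (trans [w▷k]·s≡0 (x-x≡y-y (k ▷ c) s))

module Representation (lem : LEM) (zorn : Zorn) (𝔸 : MinusRestrictAlgebra) where
  open Theory 𝔸
  open Laws 𝔸

  by-contradiction : {P : Set} → ¬ ¬ P → P
  by-contradiction {P} ¬¬p with lem (Lift (lsuc lzero) P)
  ... | inj₁ (lift p) = p
  ... | inj₂ ¬p = ⊥-elim (¬¬p (λ p → ¬p (lift p)))

  -- Excluded middle resizes a proposition in Set₁ to one in Set.
  Decided : {P : Set₁} → P ⊎ ¬ P → Set
  Decided (inj₁ _) = ⊤
  Decided (inj₂ _) = ⊥

  Resize : Set₁ → Set
  Resize P = Decided (lem P)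

  resize : ∀ {P} → P → Resize P
  resize {P} = go (lem P)
    where
    go : (d : P ⊎ ¬ P) → P → Decided d
    go (inj₁ _) _ = tt
    go (inj₂ ¬p) p = ¬p p

  unresize : ∀ {P} → Resize P → P
  unresize {P} = go (lem P)
    where
    go : (d : P ⊎ ¬ P) → Decided d → P
    go (inj₁ p) _ = p

  module _ {F : Subset} (isF : IsFilter F) where
    ∈-up : ∀ {a b} → a ∈ F → a ≤ b → b ∈ F
    ∈-up = IsFilter.upClosed isF _ _

    ∈-· : ∀ {a b} → a ∈ F → b ∈ F → (a · b) ∈ F
    ∈-· = IsFilter.meetClosed isF _ _

  isFilter : (μ : MF) → IsFilter (set μ)
  isFilter μ = IsMaximalFilter.filter (proj₂ μ)

  element : (μ : MF) → Carrier
  element μ = proj₁ (IsFilter.nonempty (isFilter μ))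

  element∈ : (μ : MF) → element μ ∈ set μ
  element∈ μ = proj₂ (IsFilter.nonempty (isFilter μ))

  x-x∉ : ∀ μ x → ¬ ((x - x) ∈ set μ)
  x-x∉ μ x 0∈μ with IsMaximalFilter.proper (proj₂ μ)
  ... | p , p∉μ = p∉μ (∈-up (isFilter μ) 0∈μ (x-x≤y x p))

  x-y∈⇒y∉ : ∀ μ {a b} → (a - b) ∈ set μ → ¬ (b ∈ set μ)
  x-y∈⇒y∉ μ {a} {b} a-b∈μ b∈μ =
    x-x∉ μ a (subst (_∈ set μ) ([x-y]·y≡x-x a b) (∈-· (isFilter μ) a-b∈μ b∈μ))

  -- Otherwise the filter generated by μ and b would be proper.
  ∉⇒∃disjoint : ∀ μ {b} → ¬ (b ∈ set μ) → ∃ λ f → f ∈ set μ × (f · b) ≡ b - b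
  ∉⇒∃disjoint μ {b} b∉μ = by-contradiction λ no-f → b∉μ (maximal G G-filter (G-proper no-f) μ⊆G b b∈G)
    where
    open IsMaximalFilter (proj₂ μ)
    G : Subset
    G y = ∃ λ f → f ∈ set μ × (f · b) ≤ y
    b∈G : b ∈ G
    b∈G = element μ , element∈ μ , x·y≤y (element μ) b
    μ⊆G : set μ ⊆ G
    μ⊆G f f∈μ = f , f∈μ , x·y≤x f b
    G-filter : IsFilter G
    IsFilter.nonempty G-filter = b , b∈G
    IsFilter.upClosed G-filter x y (f , f∈μ , f·b≤x) x≤y = f , f∈μ , ≤-trans f·b≤x x≤y
    IsFilter.meetClosed G-filter x y (f , f∈μ , f·b≤x) (g , g∈μ , g·b≤y) =
      f · g , ∈-· filter f∈μ g∈μ ,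
      glb (≤-trans (·-monoˡ-≤ b (x·y≤x f g)) f·b≤x) (≤-trans (·-monoˡ-≤ b (x·y≤y f g)) g·b≤y)
    G-proper : ¬ (∃ λ f → f ∈ set μ × (f · b) ≡ b - b) → Proper G
    G-proper no-f = b - b , λ { (f , f∈μ , f·b≤0) → no-f (f , f∈μ , x≤a-a⇒x≡a-a b f·b≤0) }

  x∈⇒y∉⇒x-y∈ : ∀ μ {a b} → a ∈ set μ → ¬ (b ∈ set μ) → (a - b) ∈ set μ
  x∈⇒y∉⇒x-y∈ μ {a} {b} a∈μ b∉μ with ∉⇒∃disjoint μ b∉μ
  ... | f , f∈μ , f·b≡0 = ∈-up (isFilter μ) (∈-· (isFilter μ) a∈μ f∈μ) (x≤y-z (x·y≤x a f) a·f·b≡0)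
    where
    a·f·b≡0 : ((a · f) · b) ≡ b - b
    a·f·b≡0 = x≤a-a⇒x≡a-a b (subst (((a · f) · b) ≤_) f·b≡0 (·-monoˡ-≤ b (x·y≤y a f)))

  ⪯-refl : ∀ μ → set μ ⪯ set μ
  ⪯-refl μ g f g∈μ f∈μ = ∈-up (isFilter μ) (∈-· (isFilter μ) g∈μ f∈μ) g·f≤g▷f
    where
    g·f≤g▷f : (g · f) ≤ (g ▷ f)
    g·f≤g▷f = subst (_≤ (g ▷ f)) (≤⇒x▷y≡x (x·y≤y g f)) (▷-monoˡ-≤ f (x·y≤x g f))

  x▷c∈⇒x▷c′∈ : ∀ μ {x c c′} → (x ▷ c) ∈ set μ → c′ ∈ set μ → (x ▷ c′) ∈ set μ
  x▷c∈⇒x▷c′∈ μ {x} {c} {c′} x▷c∈μ c′∈μ =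
    ∈-up (isFilter μ) (⪯-refl μ (x ▷ c) c′ x▷c∈μ c′∈μ) ([x▷y]▷z≤x▷z x c c′)

  ⪯-both⇒⊆ : ∀ ξ μ ν {a} → set ξ ⪯ set μ → set ξ ⪯ set ν
           → a ∈ set μ → a ∈ set ν → set μ ⊆ set ν
  ⪯-both⇒⊆ ξ μ ν {a} ξ⪯μ ξ⪯ν a∈μ a∈ν b b∈μ =
    by-contradiction λ b∉ν → x-x∉ ξ a (0∈ξ b∉ν)
    where
    c : Carrier
    c = element ξ
    0∈ξ : ¬ (b ∈ set ν) → (a - a) ∈ set ξ
    0∈ξ b∉ν = subst (_∈ set ξ) meet≡0 (∈-· (isFilter ξ) [a·b]▷c∈ξ [a-b]▷c∈ξ)
      where
      [a·b]▷c∈ξ : ((a · b) ▷ c) ∈ set ξ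
      [a·b]▷c∈ξ = ξ⪯μ (a · b) c (∈-· (isFilter μ) a∈μ b∈μ) (element∈ ξ)
      [a-b]▷c∈ξ : ((a - b) ▷ c) ∈ set ξ
      [a-b]▷c∈ξ = ξ⪯ν (a - b) c (x∈⇒y∉⇒x-y∈ ν a∈ν b∉ν) (element∈ ξ)
      meet≡0 : ((a · b) ▷ c) · ((a - b) ▷ c) ≡ a - a
      meet≡0 = trans (ax4 (a · b) (a - b) c) (trans (cong (_▷ c) ([x·y]▷[x-y]≡x-x a b)) ([x-x]▷y≡x-x a c))

  ▷-domain : ∀ ξ {a c} → c ∈ set ξ → (a ▷ c) ∈ set ξ → Σ MF λ ν → (set ξ ≈ set ν) × a ∈ set ν
  ▷-domain ξ {a} {c} c∈ξ a▷c∈ξ = (N , N-maximal) , (ξ⪯N , N⪯ξ) , a∈N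
    where
    X : Subset
    X = set ξ
    isX : IsFilter X
    isX = isFilter ξ
    N : Subset
    N y = ((y · a) ▷ c) ∈ X
    a∈N : a ∈ N
    a∈N = subst (λ t → (t ▷ c) ∈ X) (sym (ax1 a a)) a▷c∈ξ

    N-filter : IsFilter N
    IsFilter.nonempty N-filter = a , a∈N
    IsFilter.upClosed N-filter y z y∈N y≤z = ∈-up isX y∈N (▷-monoˡ-≤ c (·-monoˡ-≤ a y≤z))
    IsFilter.meetClosed N-filter y z y∈N z∈N = ∈-up isX meet∈ (▷-monoˡ-≤ c meet≤)
      where
      meet∈ : (((y · a) · (z · a)) ▷ c) ∈ X
      meet∈ = subst (_∈ X) (trans (ax4 (y · a) (z · a) c) (cong (_▷ c) ya▷za≡ya·za)) (∈-· isX y∈N z∈N)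
        where
        ya▷za≡ya·za : (y · a) ▷ (z · a) ≡ (y · a) · (z · a)
        ya▷za≡ya·za = ≤-common⇒x▷y≡x·y (x·y≤y y a) (x·y≤y z a)
      meet≤ : ((y · a) · (z · a)) ≤ ((y · z) · a)
      meet≤ = glb (glb (≤-trans (x·y≤x (y · a) (z · a)) (x·y≤x y a))
                       (≤-trans (x·y≤y (y · a) (z · a)) (x·y≤x z a)))
                  (≤-trans (x·y≤y (y · a) (z · a)) (x·y≤y z a))

    -- If y ∉ N, then a - y ∈ N, so any filter containing N and y contains 0.
    N-maximal : IsMaximalFilter N
    IsMaximalFilter.filter N-maximal = N-filter
    IsMaximalFilter.proper N-maximal = a - a , λ 0∈N → x-x∉ ξ a (subst (_∈ X) [0·a]▷c≡0 0∈N)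
      where
      [0·a]▷c≡0 : ((a - a) · a) ▷ c ≡ a - a
      [0·a]▷c≡0 = trans (cong (_▷ c) (x-x≤y a a)) ([x-x]▷y≡x-x a c)
    IsMaximalFilter.maximal N-maximal G G-filter (p , p∉G) N⊆G y y∈G =
      by-contradiction λ y∉N → p∉G (∈-up G-filter (0∈G y∉N) (x-x≤y a p))
      where
      a-y∈N : ¬ (y ∈ N) → (a - y) ∈ N
      a-y∈N y∉N = subst (λ t → (t ▷ c) ∈ X) (sym (x-y≤x a y))
                    (∈-up isX (x∈⇒y∉⇒x-y∈ ξ a▷c∈ξ y∉N)
                      (subst (λ t → ((a ▷ c) - ((y · a) ▷ c)) ≤ (t ▷ c)) (x-[y·x]≡x-y a y)
                        ([k▷c]-[s▷c]≤[k-s]▷c c (x·y≤y y a))))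
      0∈G : ¬ (y ∈ N) → (a - a) ∈ G
      0∈G y∉N = subst (_∈ G) (trans (ax2 y (a - y)) ([x-y]·y≡x-x a y))
                  (∈-· G-filter y∈G (N⊆G (a - y) (a-y∈N y∉N)))

    ξ⪯N : X ⪯ N
    ξ⪯N g f g∈N f∈X = ∈-up isX (x▷c∈⇒x▷c′∈ ξ g∈N f∈X) (▷-monoˡ-≤ f (x·y≤x g a))

    N⪯ξ : N ⪯ X
    N⪯ξ g f g∈X f∈N = ∈-up isX [g▷f·a]▷c∈ (▷-monoˡ-≤ c g▷f·a≤)
      where
      [g▷f·a]▷c∈ : ((g ▷ (f · a)) ▷ c) ∈ X
      [g▷f·a]▷c∈ = subst (_∈ X) (ax4 g (f · a) c) (∈-· isX (⪯-refl ξ g c g∈X c∈ξ) f∈N)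
      g▷f·a≤ : (g ▷ (f · a)) ≤ ((g ▷ f) · a)
      g▷f·a≤ = glb (▷-monoʳ-≤ g (x·y≤x f a)) (≤-trans (x▷y≤y g (f · a)) (x·y≤y f a))

  -- Zorn's lemma on proper filters containing d, ordered by inclusion; a chain is
  -- bounded by its union together with ↑d, which also covers the empty chain.
  maximal-filter∋ : ∀ d → ¬ (d ≡ d - d) → Σ MF λ μ → d ∈ set μ
  maximal-filter∋ d d≢0 = (proj₁ m , m-maximal) , ∋d m
    where
    Candidate : Set₁
    Candidate = Σ Subset λ F → IsFilter F × d ∈ F × ¬ ((d - d) ∈ F)

    filterOf : (F : Candidate) → IsFilter (proj₁ F)
    filterOf F = proj₁ (proj₂ F)

    ∋d : (F : Candidate) → d ∈ proj₁ F
    ∋d F = proj₁ (proj₂ (proj₂ F))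

    ∌0 : (F : Candidate) → ¬ ((d - d) ∈ proj₁ F)
    ∌0 F = proj₂ (proj₂ (proj₂ F))

    _⊑_ : Candidate → Candidate → Set
    F ⊑ G = proj₁ F ⊆ proj₁ G

    chain-bound : (C : Candidate → Set) → (∀ {F G} → C F → C G → (F ⊑ G) ⊎ (G ⊑ F))
                → Σ Candidate λ U → ∀ {F} → C F → F ⊑ U
    chain-bound C comparable = (U , U-filter , d∈U , 0∉U) , λ {F} F∈C x x∈F → resize (inj₁ (F , F∈C , x∈F))
      where
      U : Subset
      U x = Resize ((Σ Candidate λ F → C F × x ∈ proj₁ F) ⊎ Lift (lsuc lzero) (d ≤ x))
      d∈U : d ∈ U
      d∈U = resize (inj₂ (lift (≤-refl d)))
      0∉U : ¬ ((d - d) ∈ U)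
      0∉U 0∈U with unresize 0∈U
      ... | inj₁ (F , _ , 0∈F) = ∌0 F 0∈F
      ... | inj₂ (lift d≤0) = d≢0 (x≤a-a⇒x≡a-a d d≤0)
      U-filter : IsFilter U
      IsFilter.nonempty U-filter = d , d∈U
      IsFilter.upClosed U-filter x y x∈U x≤y with unresize x∈U
      ... | inj₁ (F , F∈C , x∈F) = resize (inj₁ (F , F∈C , ∈-up (filterOf F) x∈F x≤y))
      ... | inj₂ (lift d≤x) = resize (inj₂ (lift (≤-trans d≤x x≤y)))
      IsFilter.meetClosed U-filter x y x∈U y∈U with unresize x∈U | unresize y∈U
      ... | inj₁ (F , F∈C , x∈F) | inj₁ (G , G∈C , y∈G) with comparable F∈C G∈C
      ...   | inj₁ F⊑G = resize (inj₁ (G , G∈C , ∈-· (filterOf G) (F⊑G x x∈F) y∈G))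
      ...   | inj₂ G⊑F = resize (inj₁ (F , F∈C , ∈-· (filterOf F) x∈F (G⊑F y y∈G)))
      IsFilter.meetClosed U-filter x y _ _ | inj₁ (F , F∈C , x∈F) | inj₂ (lift d≤y) =
        resize (inj₁ (F , F∈C , ∈-· (filterOf F) x∈F (∈-up (filterOf F) (∋d F) d≤y)))
      IsFilter.meetClosed U-filter x y _ _ | inj₂ (lift d≤x) | inj₁ (G , G∈C , y∈G) =
        resize (inj₁ (G , G∈C , ∈-· (filterOf G) (∈-up (filterOf G) (∋d G) d≤x) y∈G))
      IsFilter.meetClosed U-filter x y _ _ | inj₂ (lift d≤x) | inj₂ (lift d≤y) =
        resize (inj₂ (lift (glb d≤x d≤y)))

    zorn-maximal : Σ Candidate λ m → ∀ F → m ⊑ F → F ⊑ m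
    zorn-maximal = zorn Candidate _⊑_ (λ _ _ x∈ → x∈) (λ F⊑G G⊑H x x∈ → G⊑H x (F⊑G x x∈)) chain-bound

    m : Candidate
    m = proj₁ zorn-maximal

    m-maximal : IsMaximalFilter (proj₁ m)
    IsMaximalFilter.filter m-maximal = filterOf m
    IsMaximalFilter.proper m-maximal = d - d , ∌0 m
    IsMaximalFilter.maximal m-maximal G G-filter (p , p∉G) m⊆G =
      proj₂ zorn-maximal (G , G-filter , m⊆G d (∋d m) , λ 0∈G → p∉G (∈-up G-filter 0∈G (x-x≤y d p))) m⊆G

  θ-partial : ∀ a → IsPartialFunction (θ a)
  θ-partial a ξ μ ν (lift ((ξ⪯μ , _) , a∈μ)) (lift ((ξ⪯ν , _) , a∈ν)) =
    ⪯-both⇒⊆ ξ μ ν ξ⪯μ ξ⪯ν a∈μ a∈ν , ⪯-both⇒⊆ ξ ν μ ξ⪯ν ξ⪯μ a∈ν a∈μ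

  θ-⊆⇒≤ : ∀ {a b} → (∀ ξ μ → θ a ξ μ → θ b ξ μ) → a ≤ b
  θ-⊆⇒≤ {a} {b} θa⊆θb = by-contradiction λ a≰b →
    separating (maximal-filter∋ (a - b) λ a-b≡0 → a≰b (x-y≡x-x⇒≤ (trans a-b≡0 (x-x≡y-y (a - b) a))))
    where
    separating : ¬ (Σ MF λ μ → (a - b) ∈ set μ)
    separating (μ , a-b∈μ) = x-y∈⇒y∉ μ a-b∈μ b∈μ
      where
      a∈μ : a ∈ set μ
      a∈μ = ∈-up (isFilter μ) a-b∈μ (x-y≤x a b)
      b∈μ : b ∈ set μ
      b∈μ = proj₂ (lower (θa⊆θb μ μ (lift ((⪯-refl μ , ⪯-refl μ) , a∈μ))))

  θ-injective : ∀ a b → θ a ≡ᴿ θ b → a ≡ b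
  θ-injective a b θa≡θb =
    ≤-antisym (θ-⊆⇒≤ λ ξ μ → proj₁ (θa≡θb ξ μ)) (θ-⊆⇒≤ λ ξ μ → proj₂ (θa≡θb ξ μ))

  θ-minus : ∀ a b → θ (a - b) ≡ᴿ (θ a -ᴿ θ b)
  θ-minus a b ξ μ = to , from
    where
    to : θ (a - b) ξ μ → (θ a -ᴿ θ b) ξ μ
    to (lift (ξ≈μ , a-b∈μ)) =
      lift (ξ≈μ , ∈-up (isFilter μ) a-b∈μ (x-y≤x a b)) ,
      λ { (lift (_ , b∈μ)) → x-y∈⇒y∉ μ a-b∈μ b∈μ }
    from : (θ a -ᴿ θ b) ξ μ → θ (a - b) ξ μ
    from (lift (ξ≈μ , a∈μ) , ¬θb) =
      lift (ξ≈μ , x∈⇒y∉⇒x-y∈ μ a∈μ λ b∈μ → ¬θb (lift (ξ≈μ , b∈μ)))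

  θ-restrict : ∀ a b → θ (a ▷ b) ≡ᴿ (θ a ▷ᴿ θ b)
  θ-restrict a b ξ μ = to , from
    where
    c : Carrier
    c = element ξ
    c∈ξ : c ∈ set ξ
    c∈ξ = element∈ ξ
    to : θ (a ▷ b) ξ μ → (θ a ▷ᴿ θ b) ξ μ
    to (lift ((ξ⪯μ , μ⪯ξ) , a▷b∈μ)) with ▷-domain ξ c∈ξ a▷c∈ξ
      where
      a▷c∈ξ : (a ▷ c) ∈ set ξ
      a▷c∈ξ = ∈-up (isFilter ξ) (ξ⪯μ (a ▷ b) c a▷b∈μ c∈ξ) ([x▷y]▷z≤x▷z a b c)
    ... | ν , ξ≈ν , a∈ν =
      lift ((ξ⪯μ , μ⪯ξ) , ∈-up (isFilter μ) a▷b∈μ (x▷y≤y a b)) , ν , lift (ξ≈ν , a∈ν)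
    from : (θ a ▷ᴿ θ b) ξ μ → θ (a ▷ b) ξ μ
    from (lift ((ξ⪯μ , μ⪯ξ) , b∈μ) , ν , lift ((ξ⪯ν , _) , a∈ν)) =
      lift ((ξ⪯μ , μ⪯ξ) , ∈-up (isFilter μ) [a▷c]▷b∈μ ([x▷y]▷z≤x▷z a c b))
      where
      [a▷c]▷b∈μ : ((a ▷ c) ▷ b) ∈ set μ
      [a▷c]▷b∈μ = μ⪯ξ (a ▷ c) b (ξ⪯ν a c a∈ν c∈ξ) b∈μ

proposition5p6 : LEM → Zorn → (𝔸 : MinusRestrictAlgebra)
    → let open Theory 𝔸 in
      (∀ a → IsPartialFunction (θ a))
      × (∀ a b → θ a ≡ᴿ θ b → a ≡ b)
      × (∀ a b → θ (a - b) ≡ᴿ (θ a -ᴿ θ b))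
      × (∀ a b → θ (a ▷ b) ≡ᴿ (θ a ▷ᴿ θ b))
proposition5p6 lem zorn 𝔸 = θ-partial , θ-injective , θ-minus , θ-restrict
  where open Representation lem zorn 𝔸
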